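{- Let $G$ be a connected graph with $n(G)\geq 4$. (a) If $G$ has a twin equivalence class of cardinality at least $4$, then $o(G)=\mathcal{S}$ and $S_{\rm MB}(G)=S'_{\rm MB}(G)=2$. (b) If $G$ has two distinct twin equivalence classes each of cardinality at least $3$, then $o(G)=\mathcal{S}$ and $S_{\rm MB}(G)=S'_{\rm MB}(G)=2$.
   Context: All graphs are finite, simple, undirected and connected with at least two vertices; $n(G)$ is the order. $N(v)$ is the open neighborhood of $v$. Vertices $u,v$ are twins if $N(u)\setminus\{v\}=N(v)\setminus\{u\}$ (every vertex is its own twin); this is an equivalence relation whose classes are the twin equivalence classes. A set $W\subseteq V(G)$ is a resolving set if for all distinct $x,y$ there is $z\in W$ with $d(x,z)\neq d(y,z)$. In the Maker-Breaker resolving game, Resolver and Spoiler alternately select (without skipping) a not-yet-selected vertex; Resolver wins if at some point his vertices form a resolving set, otherwise Spoiler wins. R-game: Resolver moves first; S-game: Spoiler moves first. $o(G)=\mathcal{S}$ means Spoiler has a winning strategy in both games. $S_{\rm MB}(G)$ (resp. $S'_{\rm MB}(G)$) is the minimum number of moves Spoiler needs to win the R-game (resp. S-game) when she has a winning strategy ($\infty$ otherwise). -}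

module Defs where

open import Level using (0ℓ)
open import Data.Nat using (ℕ; zero; suc; _<_; _≤_)
open import Data.Fin using (Fin)
open import Data.Fin.Subset using (Subset; ∁; _∪_; ⁅_⁆; _∈_; _∉_) renaming (⊥ to ∅)
open import Data.Product using (Σ; ∃; ∃-syntax; _×_; _,_)
open import Data.Sum using (_⊎_)
open import Relation.Nullary using (¬_)
open import Relation.Binary.PropositionalEquality using (_≡_; _≢_)
open import Function.Bundles using (_⇔_)
open import Function.Definitions using (Injective)

record Graph (n : ℕ) : Set₁ where
  field
    Adj     : Fin n → Fin n → Set
    sym     : ∀ {x y} → Adj x y → Adj y x
    irrefl  : ∀ {x} → ¬ Adj x x

open Graph public

data Walk {n : ℕ} (G : Graph n) : Fin n → Fin n → ℕ → Set where
  here : ∀ {x} → Walk G x x zero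
  step : ∀ {x y z k} → Adj G x y → Walk G y z k → Walk G x z (suc k)

Connected : ∀ {n} → Graph n → Set
Connected G = ∀ x y → ∃[ k ] Walk G x y k

IsDist : ∀ {n} → Graph n → Fin n → Fin n → ℕ → Set
IsDist G x y k = Walk G x y k × (∀ m → m < k → ¬ Walk G x y m)

Distinguishes : ∀ {n} → Graph n → Fin n → Fin n → Fin n → Set
Distinguishes G z x y =
  ∃[ k₁ ] ∃[ k₂ ] (IsDist G x z k₁ × IsDist G y z k₂ × k₁ ≢ k₂)

Resolving : ∀ {n} → Graph n → Subset n → Set
Resolving {n} G W =
  ∀ (x y : Fin n) → x ≢ y → ∃[ z ] (z ∈ W × Distinguishes G z x y)

Twin : ∀ {n} → Graph n → Fin n → Fin n → Set
Twin G u v = ∀ w → (Adj G u w × w ≢ v) ⇔ (Adj G v w × w ≢ u)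

TwinClassAtLeast : ∀ {n} → Graph n → Fin n → ℕ → Set
TwinClassAtLeast {n} G u m =
  Σ (Fin m → Fin n) λ f → Injective _≡_ _≡_ f × (∀ i → Twin G u (f i))

-- Position: R = Resolver's vertices, S = Spoiler's vertices.
-- Spoiler has won as soon as Resolver can no longer reach a resolving
-- set, i.e. the complement of S is not resolving.

Free : ∀ {n} → Subset n → Subset n → Fin n → Set
Free R S v = v ∉ R × v ∉ S

SpoilerHasWon : ∀ {n} → Graph n → Subset n → Set
SpoilerHasWon G S = ¬ Resolving G (∁ S)

mutual
  -- Resolver to move; Spoiler can force a win using at most k further moves.
  ForceR : ∀ {n} → Graph n → ℕ → Subset n → Subset n → Set
  ForceR G k R S =
    SpoilerHasWon G S ⊎
    ((∃[ v ] Free R S v) × (∀ v → Free R S v → ForceS G k (R ∪ ⁅ v ⁆) S))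

  ForceS : ∀ {n} → Graph n → ℕ → Subset n → Subset n → Set
  ForceS G zero    R S = SpoilerHasWon G S
  ForceS G (suc k) R S =
    SpoilerHasWon G S ⊎ (∃[ v ] (Free R S v × ForceR G k R (S ∪ ⁅ v ⁆)))

SpoilerWinsRGameIn : ∀ {n} → Graph n → ℕ → Set
SpoilerWinsRGameIn G k = ForceR G k ∅ ∅

SpoilerWinsSGameIn : ∀ {n} → Graph n → ℕ → Set
SpoilerWinsSGameIn G k = ForceS G k ∅ ∅

-- o(G) = 𝒮 : Spoiler has a winning strategy in both games
-- (the game is finite, so a winning strategy wins within some number of moves).
OutcomeS : ∀ {n} → Graph n → Set
OutcomeS G = (∃[ k ] SpoilerWinsRGameIn G k) × (∃[ k ] SpoilerWinsSGameIn G k)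

SMB≡ : ∀ {n} → Graph n → ℕ → Set
SMB≡ G m = SpoilerWinsRGameIn G m × (∀ k → k < m → ¬ SpoilerWinsRGameIn G k)

S'MB≡ : ∀ {n} → Graph n → ℕ → Set
S'MB≡ G m = SpoilerWinsSGameIn G m × (∀ k → k < m → ¬ SpoilerWinsSGameIn G k)

-- Twins u ≠ v are at equal distance from every third vertex, so no vertex
-- other than u, v separates them; once Spoiler owns two distinct twins,
-- Resolver can never complete a resolving set.  Given three pairwise twins
-- that are still free, Spoiler takes one of them, Resolver can block at
-- most one of the other two, and Spoiler takes the remaining one: a win
-- with two moves.  In the R-game Spoiler only needs, for every first move
-- r of Resolver, three pairwise twins avoiding r; a twin class of size 4
-- (part a), or two twin classes of size 3 (part b), provide them.
-- Conversely, a set with at most one vertex has a resolving complement in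
-- a connected graph, so one Spoiler move never suffices.
module Submission where

open import Defs
open import Data.Nat using (ℕ; _≤_)
open import Data.Product using (∃-syntax; _×_)
open import Relation.Nullary using (¬_)

open import Data.Nat using (zero; suc; _<_; s≤s)
open import Data.Nat.Properties using (≤-antisym; ≤-trans; ≤-refl; ≮⇒≥; n≤1+n)
open import Data.Nat.Induction using (<-rec)
open import Data.Fin using (Fin; punchIn) renaming (zero to fzero; suc to fsuc)
open import Data.Fin.Properties
  using (_≟_; any?; suc-injective; punchIn-injective; punchInᵢ≢i)
open import Data.Fin.Subset using (Subset; ∁; _∪_; ⁅_⁆; _∈_; _∉_) renaming (⊥ to ∅)
open import Data.Fin.Subset.Properties
  using (_∈?_; ∉⊥; x∈⁅x⁆; x∈⁅y⁆⇒x≡y; x∈∁p⇒x∉p; x∉p⇒x∈∁p; x∈p∪q⁻; x∈p∪q⁺)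
open import Data.Product using (Σ; _,_; proj₁; proj₂)
open import Data.Sum using (inj₁; inj₂)
open import Data.Empty using (⊥-elim)
open import Relation.Nullary using (yes; no)
open import Relation.Binary.PropositionalEquality
  using (_≡_; _≢_; refl; trans; subst) renaming (sym to ≡-sym)
open import Function.Base using (_∘_)
open import Function.Bundles using (mk⇔; Equivalence)

∉-∪⁅⁆ : ∀ {n} {x y : Fin n} {p : Subset n} → x ∉ p → x ≢ y → x ∉ p ∪ ⁅ y ⁆
∉-∪⁅⁆ {y = y} {p} x∉p x≢y x∈ with x∈p∪q⁻ p ⁅ y ⁆ x∈
... | inj₁ x∈p = x∉p x∈p
... | inj₂ x∈y = x≢y (x∈⁅y⁆⇒x≡y y x∈y)

∈-∪⁅⁆ : ∀ {n} {p : Subset n} (y : Fin n) → y ∈ p ∪ ⁅ y ⁆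
∈-∪⁅⁆ y = x∈p∪q⁺ (inj₂ (x∈⁅x⁆ y))

∈-∪-left : ∀ {n} {x : Fin n} {p q : Subset n} → x ∈ p → x ∈ p ∪ q
∈-∪-left x∈p = x∈p∪q⁺ (inj₁ x∈p)

¬¬-Fin-∀ : ∀ m {P : Fin m → Set} → (∀ i → ¬ ¬ P i) → ¬ ¬ (∀ i → P i)
¬¬-Fin-∀ zero    _  no-all = no-all (λ ())
¬¬-Fin-∀ (suc m) ¬¬P no-all =
  ¬¬P fzero λ P0 → ¬¬-Fin-∀ m (λ i → ¬¬P (fsuc i)) λ Psuc →
    no-all λ { fzero → P0 ; (fsuc i) → Psuc i }

module TwinGame {n : ℕ} (G : Graph n) where

  twin-sym : ∀ {u v} → Twin G u v → Twin G v u
  twin-sym t w = mk⇔ (Equivalence.from (t w)) (Equivalence.to (t w))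

  twin-to : ∀ {u v} → Twin G u v → ∀ w → Adj G u w → w ≢ v → Adj G v w
  twin-to t w uw w≢v = proj₁ (Equivalence.to (t w) (uw , w≢v))

  twin-from : ∀ {u v} → Twin G u v → ∀ w → Adj G v w → w ≢ u → Adj G u w
  twin-from t w vw w≢u = proj₁ (Equivalence.from (t w) (vw , w≢u))

  adj-≢ : ∀ {a w} → Adj G a w → w ≢ a
  adj-≢ adj refl = irrefl G adj

  -- For w ≠ u pass through u; for w = u (an edge a–u)
  -- use the edge b–a obtained from u–a, and then u–b from a–b.
  common-twin-adj : ∀ {u a b} → Twin G u a → Twin G u b →
                    ∀ w → Adj G a w → w ≢ b → Adj G b w
  common-twin-adj {u} {a} {b} ta tb w aw w≢b with a ≟ b | a ≟ u | w ≟ u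
  ... | yes refl | _        | _        = aw
  ... | no _     | yes refl | _        = twin-to tb w aw w≢b
  ... | no _     | no _     | no w≢u   = twin-to tb w (twin-from ta w aw w≢u) w≢b
  ... | no a≢b   | no _     | yes refl =
    Graph.sym G (twin-from ta b (Graph.sym G ba) (λ b≡u → w≢b (≡-sym b≡u)))
    where
    ba : Adj G b a
    ba = twin-to tb a (Graph.sym G aw) a≢b

  twin-trans : ∀ {a u b} → Twin G a u → Twin G u b → Twin G a b
  twin-trans ta tb w =
    mk⇔ (λ (aw , w≢b) → common-twin-adj (twin-sym ta) tb w aw w≢b , adj-≢ aw)
        (λ (bw , w≢a) → common-twin-adj tb (twin-sym ta) w bw w≢a , adj-≢ bw)

  class-twins : ∀ {u m} {f : Fin m → Fin n} → (∀ i → Twin G u (f i)) →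
                ∀ i j → Twin G (f i) (f j)
  class-twins tw i j = twin-trans (twin-sym (tw i)) (tw j)

  -- Replacing a by its twin b in a walk a ⇝ z (z ≠ a) does not lengthen it:
  -- the first step a–w becomes b–w, or is dropped when w = b.
  twin-walk : ∀ {a b z k} → Twin G a b → z ≢ a → Walk G a z k →
              ∃[ m ] (m ≤ k × Walk G b z m)
  twin-walk t z≢a here = ⊥-elim (z≢a refl)
  twin-walk {b = b} t z≢a (step {y = w} {k = k} aw rest) with w ≟ b
  ... | yes refl = k , n≤1+n k , rest
  ... | no w≢b   = suc k , ≤-refl , step (twin-to t w aw w≢b) rest

  twin-dist-≤ : ∀ {a b z k₁ k₂} → Twin G a b → z ≢ a →
                IsDist G a z k₁ → IsDist G b z k₂ → k₂ ≤ k₁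
  twin-dist-≤ t z≢a (walk₁ , _) (_ , least₂) with twin-walk t z≢a walk₁
  ... | m , m≤k₁ , walk = ≤-trans (≮⇒≥ (λ m<k₂ → least₂ m m<k₂ walk)) m≤k₁

  twins-equidistant : ∀ {a b z k₁ k₂} → Twin G a b → z ≢ a → z ≢ b →
                      IsDist G a z k₁ → IsDist G b z k₂ → k₁ ≡ k₂
  twins-equidistant t z≢a z≢b d₁ d₂ =
    ≤-antisym (twin-dist-≤ (twin-sym t) z≢b d₂ d₁) (twin-dist-≤ t z≢a d₁ d₂)

  -- Hence once Spoiler owns two distinct twins, nothing Resolver can still
  -- choose separates them: Spoiler has won.
  owned-twins-win : ∀ {a b S} → Twin G a b → a ≢ b → a ∈ S → b ∈ S →
                    SpoilerHasWon G S
  owned-twins-win {a} {b} {S} t a≢b a∈S b∈S resolving with resolving a b a≢b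
  ... | z , z∈∁S , k₁ , k₂ , d₁ , d₂ , k₁≢k₂ =
    k₁≢k₂ (twins-equidistant t z≢a z≢b d₁ d₂)
    where
    z≢a : z ≢ a
    z≢a refl = x∈∁p⇒x∉p z∈∁S a∈S
    z≢b : z ≢ b
    z≢b refl = x∈∁p⇒x∉p z∈∁S b∈S

  i₀ i₁ i₂ : Fin 3
  i₀ = fzero
  i₁ = fsuc fzero
  i₂ = fsuc (fsuc fzero)

  -- From any position in which three pairwise twins are free, Spoiler wins
  -- within two moves: she takes the first; Resolver blocks at most one of
  -- the other two; she takes one not blocked.
  claim-twin-triple : ∀ {u R S} (c : TwinClassAtLeast G u 3) →
                      (∀ i → Free R S (proj₁ c i)) → ForceS G 2 R S
  claim-twin-triple {R = R} {S} (f , inj , tw) free =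
    inj₂ (f i₀ , free i₀ ,
          inj₂ ((f i₁ , proj₁ (free i₁) , ∉-∪⁅⁆ (proj₂ (free i₁)) (distinct λ ())) ,
                reply))
    where
    distinct : ∀ {i j} → i ≢ j → f i ≢ f j
    distinct i≢j fi≡fj = i≢j (inj fi≡fj)

    take : ∀ w j → j ≢ i₀ → f j ≢ w → ForceS G 1 (R ∪ ⁅ w ⁆) (S ∪ ⁅ f i₀ ⁆)
    take w j j≢i₀ fj≢w =
      inj₂ (f j , (∉-∪⁅⁆ (proj₁ (free j)) fj≢w , ∉-∪⁅⁆ (proj₂ (free j)) (distinct j≢i₀)) ,
            inj₁ (owned-twins-win (class-twins tw i₀ j)
                    (distinct (λ i₀≡j → j≢i₀ (≡-sym i₀≡j)))
                    (∈-∪-left (∈-∪⁅⁆ (f i₀))) (∈-∪⁅⁆ (f j))))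

    reply : ∀ w → Free R (S ∪ ⁅ f i₀ ⁆) w → ForceS G 1 (R ∪ ⁅ w ⁆) (S ∪ ⁅ f i₀ ⁆)
    reply w _ with f i₁ ≟ w
    ... | yes f₁≡w = take w i₂ (λ ()) (λ f₂≡w → distinct (λ ()) (trans f₂≡w (≡-sym f₁≡w)))
    ... | no f₁≢w  = take w i₁ (λ ()) f₁≢w

  Avoids : ∀ {u m} → TwinClassAtLeast G u m → Fin n → Set
  Avoids c r = ∀ i → proj₁ c i ≢ r

  TwinTripleAvoiding : Fin n → Set
  TwinTripleAvoiding r = ∃[ u ] Σ (TwinClassAtLeast G u 3) (λ c → Avoids c r)

  spoiler-wins-S-game : ∀ {u} → TwinClassAtLeast G u 3 → SpoilerWinsSGameIn G 2
  spoiler-wins-S-game c = claim-twin-triple c (λ _ → ∉⊥ , ∉⊥)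

  -- In the R-game Spoiler answers Resolver's first vertex r with a triple
  -- avoiding r.
  spoiler-wins-R-game : Fin n → (∀ r → TwinTripleAvoiding r) → SpoilerWinsRGameIn G 2
  spoiler-wins-R-game v triple = inj₂ ((v , ∉⊥ , ∉⊥) , answer)
    where
    answer : ∀ r → Free ∅ ∅ r → ForceS G 2 (∅ ∪ ⁅ r ⁆) ∅
    answer r _ with triple r
    ... | _ , c , avoids = claim-twin-triple c (λ i → ∉-∪⁅⁆ ∉⊥ (avoids i) , ∉⊥)

  AtMostOne : Subset n → Set
  AtMostOne S = ∀ {x y} → x ∈ S → y ∈ S → x ≡ y

  ∅-at-most-one : AtMostOne ∅
  ∅-at-most-one x∈∅ _ = ⊥-elim (∉⊥ x∈∅)

  singleton-at-most-one : ∀ w → AtMostOne (∅ ∪ ⁅ w ⁆)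
  singleton-at-most-one w x∈ y∈ = trans (is-w x∈) (≡-sym (is-w y∈))
    where
    is-w : ∀ {x} → x ∈ ∅ ∪ ⁅ w ⁆ → x ≡ w
    is-w x∈ with x∈p∪q⁻ ∅ ⁅ w ⁆ x∈
    ... | inj₁ x∈∅ = ⊥-elim (∉⊥ x∈∅)
    ... | inj₂ x∈w = x∈⁅y⁆⇒x≡y w x∈w

  -- Distances exist classically: a shortest walk can be found under ¬¬.
  ¬¬-distance : ∀ {x y} k → Walk G x y k → ¬ ¬ (∃[ m ] IsDist G x y m)
  ¬¬-distance {x} {y} = <-rec (λ k → Walk G x y k → ¬ ¬ (∃[ m ] IsDist G x y m))
    λ k shorter walk no-dist →
      no-dist (k , walk , λ m m<k walk′ → shorter m<k walk′ no-dist)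

  walk-zero : ∀ {x y} → Walk G x y 0 → x ≡ y
  walk-zero here = refl

  dist-zero : ∀ {x} → IsDist G x x 0
  dist-zero = here , λ _ ()

  distinguishes-sym : ∀ {z x y} → Distinguishes G z x y → Distinguishes G z y x
  distinguishes-sym (k₁ , k₂ , d₁ , d₂ , k₁≢k₂) =
    k₂ , k₁ , d₂ , d₁ , λ k₂≡k₁ → k₁≢k₂ (≡-sym k₂≡k₁)

  self-distinguishes : ∀ {x y k} → x ≢ y → IsDist G y x k → Distinguishes G x x y
  self-distinguishes {x} {y} x≢y d =
    0 , _ , dist-zero , d ,
    λ 0≡k → x≢y (≡-sym (walk-zero (subst (Walk G y x) (≡-sym 0≡k) (proj₁ d))))

  -- In a connected graph the complement of a set with at most one vertex
  -- resolves: of two distinct vertices one lies outside the set.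
  small-sets-lose : Connected G → ∀ {S} → AtMostOne S → ¬ SpoilerHasWon G S
  small-sets-lose connected {S} at-most-one not-resolving =
    ¬¬-Fin-∀ n (λ x → ¬¬-Fin-∀ n (λ y → separate x y)) not-resolving
    where
    separate : ∀ x y → ¬ ¬ (x ≢ y → ∃[ z ] (z ∈ ∁ S × Distinguishes G z x y))
    separate x y no-sep with x ∈? S
    ... | no x∉S = ¬¬-distance _ (proj₂ (connected y x)) λ (_ , d) →
      no-sep λ x≢y → x , x∉p⇒x∈∁p x∉S , self-distinguishes x≢y d
    ... | yes x∈S = ¬¬-distance _ (proj₂ (connected x y)) λ (_ , d) →
      no-sep λ x≢y →
        y , x∉p⇒x∈∁p (λ y∈S → x≢y (at-most-one x∈S y∈S)) ,
        distinguishes-sym (self-distinguishes (λ y≡x → x≢y (≡-sym y≡x)) d)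

  no-win-without-moves : Connected G → ∀ {R S} → AtMostOne S → ¬ ForceR G 0 R S
  no-win-without-moves con one (inj₁ won)               = small-sets-lose con one won
  no-win-without-moves con one (inj₂ ((v , free) , next)) = small-sets-lose con one (next v free)

  no-win-in-one-move-S : Connected G → ∀ {R} → ¬ ForceS G 1 R ∅
  no-win-in-one-move-S con (inj₁ won)           = small-sets-lose con ∅-at-most-one won
  no-win-in-one-move-S con (inj₂ (v , _ , rest)) =
    no-win-without-moves con (singleton-at-most-one v) rest

  no-win-in-one-move-R : Connected G → ∀ {R} → ¬ ForceR G 1 R ∅
  no-win-in-one-move-R con (inj₁ won)               = small-sets-lose con ∅-at-most-one won
  no-win-in-one-move-R con (inj₂ ((v , free) , next)) = no-win-in-one-move-S con (next v free)

  r-game-needs-two : Connected G → ∀ k → k < 2 → ¬ SpoilerWinsRGameIn G k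
  r-game-needs-two con zero          _ = no-win-without-moves con ∅-at-most-one
  r-game-needs-two con (suc zero)    _ = no-win-in-one-move-R con
  r-game-needs-two con (suc (suc k)) (s≤s (s≤s ()))

  s-game-needs-two : Connected G → ∀ k → k < 2 → ¬ SpoilerWinsSGameIn G k
  s-game-needs-two con zero          _ = small-sets-lose con ∅-at-most-one
  s-game-needs-two con (suc zero)    _ = no-win-in-one-move-S con
  s-game-needs-two con (suc (suc k)) (s≤s (s≤s ()))

  drop-member-avoiding : ∀ {u m} → TwinClassAtLeast G u (suc m) → ∀ r →
                         Σ (TwinClassAtLeast G u m) (λ c → Avoids c r)
  drop-member-avoiding (f , inj , tw) r with any? (λ i → f i ≟ r)
  ... | yes (i , fᵢ≡r) =
    (f ∘ punchIn i , (λ e → punchIn-injective i _ _ (inj e)) , tw ∘ punchIn i) ,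
    λ j fⱼ≡r → punchInᵢ≢i i j (inj (trans fⱼ≡r (≡-sym fᵢ≡r)))
  ... | no none-is-r =
    (f ∘ fsuc , (λ e → suc-injective (inj e)) , tw ∘ fsuc) ,
    λ j fⱼ≡r → none-is-r (fsuc j , fⱼ≡r)

  class-of-four-triples : ∀ {u} → TwinClassAtLeast G u 4 → ∀ r → TwinTripleAvoiding r
  class-of-four-triples c r = _ , drop-member-avoiding c r

  classes-disjoint : ∀ {u u′ m m′} → ¬ Twin G u u′ →
                     (c : TwinClassAtLeast G u m) (c′ : TwinClassAtLeast G u′ m′) →
                     ∀ i j → proj₁ c′ j ≢ proj₁ c i
  classes-disjoint {u′ = u′} not-twins (f , _ , tw) (g , _ , tw′) i j gⱼ≡fᵢ =
    not-twins (twin-trans (tw i) (twin-sym (subst (Twin G u′) gⱼ≡fᵢ (tw′ j))))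

  -- If r lies in the first class, the second class avoids it.
  two-classes-triples : ∀ {u u′} → ¬ Twin G u u′ →
                        TwinClassAtLeast G u 3 → TwinClassAtLeast G u′ 3 →
                        ∀ r → TwinTripleAvoiding r
  two-classes-triples {u} {u′} not-twins c c′ r with any? (λ i → proj₁ c i ≟ r)
  ... | yes (i , fᵢ≡r) =
    u′ , c′ , λ j gⱼ≡r → classes-disjoint not-twins c c′ i j (trans gⱼ≡r (≡-sym fᵢ≡r))
  ... | no none-is-r = u , c , λ i fᵢ≡r → none-is-r (i , fᵢ≡r)

  outcome-from-triples : Connected G → Fin n → (∀ r → TwinTripleAvoiding r) →
                         OutcomeS G × SMB≡ G 2 × S'MB≡ G 2
  outcome-from-triples con v triples =
    ((2 , r-win) , (2 , s-win)) , (r-win , r-game-needs-two con) , (s-win , s-game-needs-two con)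
    where
    r-win : SpoilerWinsRGameIn G 2
    r-win = spoiler-wins-R-game v triples
    s-win : SpoilerWinsSGameIn G 2
    s-win = spoiler-wins-S-game (proj₁ (proj₂ (triples v)))

proposition3p2 : ∀ (n : ℕ) (G : Graph n) → Connected G → 4 ≤ n →
    ((∃[ u ] TwinClassAtLeast G u 4)
       → OutcomeS G × SMB≡ G 2 × S'MB≡ G 2)
    × ((∃[ u ] ∃[ u' ] (¬ Twin G u u' × TwinClassAtLeast G u 3 × TwinClassAtLeast G u' 3))
       → OutcomeS G × SMB≡ G 2 × S'MB≡ G 2)
proposition3p2 n G connected _ = part-a , part-b
  where
  open TwinGame G

  part-a : (∃[ u ] TwinClassAtLeast G u 4) → OutcomeS G × SMB≡ G 2 × S'MB≡ G 2
  part-a (_ , c) = outcome-from-triples connected (proj₁ c fzero) (class-of-four-triples c)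

  part-b : (∃[ u ] ∃[ u' ] (¬ Twin G u u' × TwinClassAtLeast G u 3 × TwinClassAtLeast G u' 3))
           → OutcomeS G × SMB≡ G 2 × S'MB≡ G 2
  part-b (_ , _ , not-twins , c , c′) =
    outcome-from-triples connected (proj₁ c fzero) (two-classes-triples not-twins c c′)
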